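{- Every arborescence of order $n$ with $k$ leaves is $(n+k-1)$-unavoidable.
   Context: A tournament is an orientation of a complete graph. A digraph $D$ is $m$-unavoidable if every tournament of order $m$ contains $D$ as a subdigraph. An oriented tree is an orientation of a tree. An out-arborescence (resp. in-arborescence) is an oriented tree in which all arcs are oriented away from (resp. towards) a fixed vertex, the root; an arborescence is either an in-arborescence or an out-arborescence. A leaf of an oriented tree is a vertex adjacent to at most one vertex. -}

module Defs where

open import Data.Nat using (ℕ; zero; suc; _+_; _∸_)
open import Data.Bool using (Bool; true; false; _∨_; if_then_else_)
open import Data.Fin using (Fin)
open import Data.List using (List; map; length; filter)
open import Data.Nat.ListAction using (sum)
open import Data.List using () renaming (allFin to allFinL)
open import Data.Product using (Σ; _×_)
open import Data.Sum using (_⊎_)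
open import Function.Definitions using (Injective)
open import Relation.Binary.PropositionalEquality using (_≡_; _≢_)
open import Relation.Binary.Construct.Closure.ReflexiveTransitive using (Star)
open import Relation.Nullary using (¬_)
open import Relation.Nullary.Decidable using ()
open import Data.Nat using (_≤?_)

Digraph : ℕ → Set
Digraph n = Fin n → Fin n → Bool

Arc : ∀ {n} → Digraph n → Fin n → Fin n → Set
Arc D u v = D u v ≡ true

-- A tournament of order m: an orientation of the complete graph K_m,
-- i.e. loopless, and for distinct u, v exactly one of u → v, v → u.
record Tournament (m : ℕ) : Set where
  field
    arc        : Digraph m
    irreflexive : ∀ u → arc u u ≡ false
    exactlyOne : ∀ u v → u ≢ v → arc u v ≢ arc v u

Contains : ∀ {m n} → Tournament m → Digraph n → Set
Contains {m} {n} T D =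
  Σ (Fin n → Fin m) λ f → Injective _≡_ _≡_ f ×
    (∀ u v → Arc D u v → Arc (Tournament.arc T) (f u) (f v))

Unavoidable : ℕ → ∀ {n} → Digraph n → Set
Unavoidable m D = (T : Tournament m) → Contains T D

arcCount : ∀ {n} → Digraph n → ℕ
arcCount {n} D =
  sum (map (λ u → length (filter (λ v → D u v ≡? true) (allFinL n))) (allFinL n))
  where
    open import Data.Bool.Properties using () renaming (_≟_ to _≡?_)

adjacent : ∀ {n} → Digraph n → Fin n → Fin n → Bool
adjacent D u v = D u v ∨ D v u

degree : ∀ {n} → Digraph n → Fin n → ℕ
degree {n} D u = length (filter (λ v → adjacent D u v ≡? true) (allFinL n))
  where
    open import Data.Bool.Properties using () renaming (_≟_ to _≡?_)

leafCount : ∀ {n} → Digraph n → ℕ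
leafCount {n} D = length (filter (λ u → degree D u ≤? 1) (allFinL n))

IsOriented : ∀ {n} → Digraph n → Set
IsOriented D = (∀ u → D u u ≡ false) × (∀ u v → Arc D u v → ¬ Arc D v u)

Path : ∀ {n} → Digraph n → Fin n → Fin n → Set
Path D = Star (Arc D)

-- Out-arborescence with root r: an oriented tree (underlying graph connected with
-- n − 1 edges) in which the (unique tree) path from r to every vertex is
-- directed away from r, i.e. all arcs are oriented away from r.
-- Connectivity of the underlying graph follows from the reachability condition.
IsOutArborescence : ∀ {n} → Digraph n → Fin n → Set
IsOutArborescence {n} D r =
  IsOriented D × (arcCount D + 1 ≡ n) × (∀ v → Path D r v)

IsInArborescence : ∀ {n} → Digraph n → Fin n → Set
IsInArborescence {n} D r =
  IsOriented D × (arcCount D + 1 ≡ n) × (∀ v → Path D v r)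

IsArborescence : ∀ {n} → Digraph n → Set
IsArborescence {n} D =
  Σ (Fin n) λ r → IsOutArborescence D r ⊎ IsInArborescence D r

{-# OPTIONS --safe #-}
-- The median-order argument of Havet and Thomassé. Order the vertices of the tournament so that
-- every vertex dominates at least half of each interval directly following it (a local median
-- order): one exists, because moving a vertex behind an interval where this fails strictly
-- increases the number of forward arcs. Embed the out-arborescence greedily along this order:
-- position i receives an unembedded child of the earliest embedded vertex that dominates i and
-- still has an unembedded child, and stays free if there is none. The median property then
-- bounds the free positions by the positions holding leaves. So if some vertex were still
-- unembedded after n + k − 1 positions, at most n − 1 of them would be occupied and at most
-- k − 1 free, which is absurd. In-arborescences follow by reversing all arcs.
module Submission where

open import Defs

open import Level using (Level)
open import Data.Bool using (true; false)
open import Data.Bool.Properties using (∨-comm) renaming (_≟_ to _≟ᴮ_)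
open import Data.Empty using (⊥; ⊥-elim)
open import Data.Fin using (Fin; zero; suc; fromℕ<)
open import Data.Fin.Properties using (any?; all?; toℕ<n)
  renaming (_≟_ to _≟ᶠ_; 0≢1+n to 0≢1+nᶠ; suc-injective to suc-injectiveᶠ)
open import Data.List using (List; []; _∷_; _++_; length; take; drop; allFin; tabulate; filter; map)
open import Data.List.Properties using (take++drop≡id; length-tabulate)
open import Data.List.Relation.Binary.Permutation.Propositional using (_↭_; ↭-refl; ↭-sym; ↭-trans; ↭⇒↭ₛ)
open import Data.List.Relation.Binary.Permutation.Propositional.Properties using (↭-length; ++⁺ˡ; shift)
open import Data.List.Relation.Unary.All using (All; []; _∷_)
import Data.List.Relation.Unary.All.Properties as AllP
open import Data.List.Relation.Unary.AllPairs using (_∷_)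
open import Data.List.Relation.Unary.Unique.Propositional using (Unique)
open import Data.List.Relation.Unary.Unique.Propositional.Properties using (allFin⁺)
open import Data.Maybe using (Maybe; just; nothing; fromMaybe)
open import Data.Maybe.Properties using (just-injective) renaming (≡-dec to ≡-decᴹ)
open import Data.Nat using (ℕ; zero; suc; _+_; _*_; _∸_; _≤_; _<_; z≤n; s≤s; _≤?_; _<?_)
open import Data.Nat.Induction using (<-rec)
open import Data.Nat.ListAction using () renaming (sum to sumᴸ)
open import Data.Nat.Properties
open import Data.Nat.Tactic.RingSolver using (solve-∀)
open import Data.Product using (∃; _×_; _,_; proj₁; proj₂)
open import Data.Sum using (_⊎_; inj₁; inj₂)
open import Data.Unit using (⊤; tt)
open import Function using (_∘_; flip; id)
open import Function.Definitions using (Injective)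
open import Relation.Binary.Construct.Closure.ReflexiveTransitive using (Star; ε; _◅_; reverse)
open import Relation.Binary.PropositionalEquality
open import Relation.Nullary using (¬_; Dec; yes; no; ¬?; _×-dec_; _⊎-dec_; _→-dec_)
open import Relation.Unary using (Pred; Decidable)
open import Algebra.Properties.CommutativeSemigroup +-commutativeSemigroup using ()
  renaming (interchange to +-interchange)
open import Algebra.Properties.CommutativeMonoid.Sum +-0-commutativeMonoid
  using (sum; ∑-distrib-+; ∑-comm; sum-cong-≗; sum-replicate-zero)

private
  variable
    ℓ ℓ′ : Level
    X Y Z : Set ℓ
    n : ℕ

𝟙 : Dec X → ℕ
𝟙 (yes _) = 1
𝟙 (no _)  = 0

𝟙≤1 : (d : Dec X) → 𝟙 d ≤ 1
𝟙≤1 (yes _) = ≤-refl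
𝟙≤1 (no _)  = z≤n

𝟙-yes : (d : Dec X) → X → 𝟙 d ≡ 1
𝟙-yes (yes _) _ = refl
𝟙-yes (no ¬a) a = ⊥-elim (¬a a)

𝟙-no : (d : Dec X) → ¬ X → 𝟙 d ≡ 0
𝟙-no (yes a) ¬a = ⊥-elim (¬a a)
𝟙-no (no _)  _  = refl

𝟙-mono : (d : Dec X) (e : Dec Y) → (X → Y) → 𝟙 d ≤ 𝟙 e
𝟙-mono (yes a) (yes _) f = ≤-refl
𝟙-mono (yes a) (no ¬b) f = ⊥-elim (¬b (f a))
𝟙-mono (no _)  _       f = z≤n

𝟙-¬ : (d : Dec X) → 𝟙 (¬? d) + 𝟙 d ≡ 1
𝟙-¬ (yes _) = refl
𝟙-¬ (no _)  = refl

𝟙-disjoint : (d : Dec X) (e : Dec Y) → (X → Y → ⊥) → 𝟙 d + 𝟙 e ≤ 1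
𝟙-disjoint (yes a) (yes b) h = ⊥-elim (h a b)
𝟙-disjoint (yes _) (no _)  h = ≤-refl
𝟙-disjoint (no _)  e       h = 𝟙≤1 e

𝟙-cover : (d : Dec X) (e : Dec Y) → (¬ X → Y) → 1 ≤ 𝟙 d + 𝟙 e
𝟙-cover (yes _) e       h = s≤s z≤n
𝟙-cover (no ¬a) (yes _) h = s≤s z≤n
𝟙-cover (no ¬a) (no ¬b) h = ⊥-elim (¬b (h ¬a))

𝟙-union : (d : Dec X) (e : Dec Y) (f : Dec Z) →
          (X → Z) → (Y → Z) → (X → Y → ⊥) → 𝟙 d + 𝟙 e ≤ 𝟙 f
𝟙-union (yes x) (yes y) f x⇒z y⇒z disj = ⊥-elim (disj x y)
𝟙-union (yes x) (no _)  f x⇒z y⇒z disj = ≤-reflexive (sym (𝟙-yes f (x⇒z x)))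
𝟙-union (no _)  (yes y) f x⇒z y⇒z disj = ≤-reflexive (sym (𝟙-yes f (y⇒z y)))
𝟙-union (no _)  (no _)  f x⇒z y⇒z disj = z≤n

sum-mono-≤ : {f g : Fin n → ℕ} → (∀ i → f i ≤ g i) → sum f ≤ sum g
sum-mono-≤ {zero}  f≤g = z≤n
sum-mono-≤ {suc n} f≤g = +-mono-≤ (f≤g zero) (sum-mono-≤ (f≤g ∘ suc))

sum-mono-< : {f g : Fin n → ℕ} → (∀ i → f i ≤ g i) → ∀ j → f j < g j → sum f < sum g
sum-mono-< {suc n} f≤g zero    fj<gj = +-mono-<-≤ fj<gj (sum-mono-≤ (f≤g ∘ suc))
sum-mono-< {suc n} f≤g (suc j) fj<gj = +-mono-≤-< (f≤g zero) (sum-mono-< (f≤g ∘ suc) j fj<gj)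

sum-ones : ∀ n → sum {n} (λ _ → 1) ≡ n
sum-ones zero    = refl
sum-ones (suc n) = cong suc (sum-ones n)

count : {P : Pred (Fin n) ℓ} → Decidable P → ℕ
count P? = sum (λ i → 𝟙 (P? i))

module _ {P : Pred (Fin n) ℓ} (P? : Decidable P) where

  count-mono : {Q : Pred (Fin n) ℓ′} (Q? : Decidable Q) → (∀ {i} → P i → Q i) → count P? ≤ count Q?
  count-mono Q? P⇒Q = sum-mono-≤ (λ i → 𝟙-mono (P? i) (Q? i) P⇒Q)

  count-mono-< : {Q : Pred (Fin n) ℓ′} (Q? : Decidable Q) → (∀ {i} → P i → Q i) →
                 ∀ {j} → Q j → ¬ P j → count P? < count Q?
  count-mono-< Q? P⇒Q {j} qj ¬pj = sum-mono-< (λ i → 𝟙-mono (P? i) (Q? i) P⇒Q) j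
    (subst₂ _<_ (sym (𝟙-no (P? j) ¬pj)) (sym (𝟙-yes (Q? j) qj)) ≤-refl)

count-pos : {P : Pred (Fin n) ℓ} (P? : Decidable P) → ∀ {i} → P i → 1 ≤ count P?
count-pos {suc n} P? {zero}  pi = ≤-trans (≤-reflexive (sym (𝟙-yes (P? zero) pi))) (m≤m+n _ _)
count-pos {suc n} P? {suc i} pi = ≤-trans (count-pos (P? ∘ suc) pi) (m≤n+m _ _)

𝟙∃≤count : {P : Pred (Fin n) ℓ} (P? : Decidable P) (d : Dec (∃ P)) → 𝟙 d ≤ count P?
𝟙∃≤count P? (yes (_ , pi)) = count-pos P? pi
𝟙∃≤count P? (no _)         = z≤n

count-≥2 : {P : Pred (Fin n) ℓ} (P? : Decidable P) → ∀ {i j} → i ≢ j → P i → P j → 2 ≤ count P?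
count-≥2 P? {zero}  {zero}  i≢j _  _  = ⊥-elim (i≢j refl)
count-≥2 P? {zero}  {suc j} _   pi pj = +-mono-≤ (≤-reflexive (sym (𝟙-yes (P? zero) pi))) (count-pos (P? ∘ suc) pj)
count-≥2 P? {suc i} {zero}  _   pi pj = +-mono-≤ (≤-reflexive (sym (𝟙-yes (P? zero) pj))) (count-pos (P? ∘ suc) pi)
count-≥2 P? {suc i} {suc j} i≢j pi pj =
  ≤-trans (count-≥2 (P? ∘ suc) (i≢j ∘ cong suc) pi pj) (m≤n+m _ (𝟙 (P? zero)))

count-none : {P : Pred (Fin n) ℓ} (P? : Decidable P) → (∀ i → ¬ P i) → count P? ≡ 0
count-none {n} P? none = trans (sum-cong-≗ (λ i → 𝟙-no (P? i) (none i))) (sum-replicate-zero n)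

count-≤1 : {P : Pred (Fin n) ℓ} (P? : Decidable P) → (∀ {i j} → P i → P j → i ≡ j) → count P? ≤ 1
count-≤1 {zero}  P? unique = z≤n
count-≤1 {suc n} P? unique with P? zero
... | yes p₀ = s≤s (≤-reflexive (count-none (P? ∘ suc) (λ i pi → 0≢1+nᶠ (unique p₀ pi))))
... | no _   = count-≤1 (P? ∘ suc) (λ pi pj → suc-injectiveᶠ (unique pi pj))

leastWitness : {P : Pred ℕ ℓ} → Decidable P → ∀ {t} → P t → ∃ λ s → P s × (∀ {s′} → P s′ → s ≤ s′)
leastWitness {P = P} P? {t} = <-rec (λ t → P t → ∃ λ s → P s × (∀ {s′} → P s′ → s ≤ s′)) step t
  where
  step : ∀ t → (∀ {s} → s < t → P s → ∃ λ s → P s × (∀ {s′} → P s′ → s ≤ s′)) →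
         P t → ∃ λ s → P s × (∀ {s′} → P s′ → s ≤ s′)
  step t rec pt with anyUpTo? P? t
  ... | yes (s , s<t , ps) = rec s<t ps
  ... | no none            = t , pt , λ {s′} ps′ → ≮⇒≥ (λ s′<t → none (s′ , s′<t , ps′))

argmin : {P : Pred (Fin n) ℓ} → Decidable P → (g : Fin n → ℕ) →
         ∃ P → ∃ λ w → P w × (∀ {w′} → P w′ → g w ≤ g w′)
argmin {P = P} P? g (w , pw) with leastWitness attains? {g w} (w , pw , refl)
  where
  attains? : Decidable (λ q → ∃ λ w → P w × g w ≡ q)
  attains? q = any? (λ w → P? w ×-dec (g w ≟ q))
... | _ , (w′ , pw′ , refl) , least = w′ , pw′ , λ {w″} pw″ → least (w″ , pw″ , refl)

argmax : {P : Pred (Fin n) ℓ} → Decidable P → (g : Fin n → ℕ) →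
         ∃ P → ∃ λ w → P w × (∀ {w′} → P w′ → g w′ ≤ g w)
argmax {suc n} {P = P} P? g (w , pw) with any? (P? ∘ suc)
... | no none = zero , p₀ w pw , λ { {zero} _ → ≤-refl ; {suc i} pi → ⊥-elim (none (i , pi)) }
  where
  p₀ : ∀ w → P w → P zero
  p₀ zero    p = p
  p₀ (suc i) p = ⊥-elim (none (i , p))
... | yes ex with argmax (P? ∘ suc) (g ∘ suc) ex | P? zero
... | w , pw′ , max | no ¬p₀ = suc w , pw′ , λ { {zero} p → ⊥-elim (¬p₀ p) ; {suc i} pi → max pi }
... | w , pw′ , max | yes p₀ with g zero ≤? g (suc w)
...   | yes le = suc w , pw′ , λ { {zero} _ → le ; {suc i} pi → max pi }
...   | no gt  = zero , p₀ , λ { {zero} _ → ≤-refl ; {suc i} pi → ≤-trans (max pi) (<⇒≤ (≰⇒> gt)) }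

intervalSum : (ℕ → ℕ) → ℕ → ℕ → ℕ
intervalSum f a zero    = 0
intervalSum f a (suc l) = f a + intervalSum f (suc a) l

countIn : {P : Pred ℕ ℓ} → Decidable P → ℕ → ℕ → ℕ
countIn P? = intervalSum (λ p → 𝟙 (P? p))

InInterval : ℕ → ℕ → ℕ → Set
InInterval a l p = a ≤ p × p < a + l

head∈interval : ∀ a l → InInterval a (suc l) a
head∈interval a l = ≤-refl , subst (a <_) (sym (+-suc a l)) (s≤s (m≤m+n a l))

tail⊆interval : ∀ {a l p} → InInterval (suc a) l p → InInterval a (suc l) p
tail⊆interval {a} {l} {p} (a<p , p<) = <⇒≤ a<p , subst (p <_) (sym (+-suc a l)) p<

intervalSum-mono : ∀ {f g} a l → (∀ {p} → InInterval a l p → f p ≤ g p) →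
                   intervalSum f a l ≤ intervalSum g a l
intervalSum-mono a zero    f≤g = z≤n
intervalSum-mono a (suc l) f≤g =
  +-mono-≤ (f≤g (head∈interval a l)) (intervalSum-mono (suc a) l (f≤g ∘ tail⊆interval))

intervalSum-+ : ∀ f g a l → intervalSum (λ p → f p + g p) a l ≡ intervalSum f a l + intervalSum g a l
intervalSum-+ f g a zero    = refl
intervalSum-+ f g a (suc l) = begin
  (f a + g a) + intervalSum (λ p → f p + g p) (suc a) l   ≡⟨ cong (f a + g a +_) (intervalSum-+ f g (suc a) l) ⟩
  (f a + g a) + (intervalSum f (suc a) l + intervalSum g (suc a) l)  ≡⟨ +-interchange (f a) (g a) _ _ ⟩
  (f a + intervalSum f (suc a) l) + (g a + intervalSum g (suc a) l)  ∎
  where open ≡-Reasoning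

intervalSum-ones : ∀ a l → intervalSum (λ _ → 1) a l ≡ l
intervalSum-ones a zero    = refl
intervalSum-ones a (suc l) = cong suc (intervalSum-ones (suc a) l)

intervalSum-split : ∀ f a l₁ l₂ → intervalSum f a (l₁ + l₂) ≡ intervalSum f a l₁ + intervalSum f (a + l₁) l₂
intervalSum-split f a zero     l₂ = cong (λ x → intervalSum f x l₂) (sym (+-identityʳ a))
intervalSum-split f a (suc l₁) l₂ = begin
  f a + intervalSum f (suc a) (l₁ + l₂)                          ≡⟨ cong (f a +_) (intervalSum-split f (suc a) l₁ l₂) ⟩
  f a + (intervalSum f (suc a) l₁ + intervalSum f (suc a + l₁) l₂) ≡⟨ sym (+-assoc (f a) _ _) ⟩
  f a + intervalSum f (suc a) l₁ + intervalSum f (suc a + l₁) l₂ ≡⟨ cong (λ x → f a + intervalSum f (suc a) l₁ + intervalSum f x l₂) (sym (+-suc a l₁)) ⟩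
  f a + intervalSum f (suc a) l₁ + intervalSum f (a + suc l₁) l₂ ∎
  where open ≡-Reasoning

intervalSum-snoc : ∀ f a l → intervalSum f a (suc l) ≡ intervalSum f a l + f (a + l)
intervalSum-snoc f a l = begin
  intervalSum f a (suc l)                          ≡⟨ cong (intervalSum f a) (+-comm 1 l) ⟩
  intervalSum f a (l + 1)                          ≡⟨ intervalSum-split f a l 1 ⟩
  intervalSum f a l + (f (a + l) + 0)              ≡⟨ cong (intervalSum f a l +_) (+-identityʳ _) ⟩
  intervalSum f a l + f (a + l)                    ∎
  where open ≡-Reasoning

intervalSum-shift : ∀ f a l → intervalSum f (suc a) l ≡ intervalSum (f ∘ suc) a l
intervalSum-shift f a zero    = refl
intervalSum-shift f a (suc l) = cong (f (suc a) +_) (intervalSum-shift f (suc a) l)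

module _ {P : Pred ℕ ℓ} (P? : Decidable P) where

  countIn-mono : {Q : Pred ℕ ℓ′} (Q? : Decidable Q) → ∀ a l →
                 (∀ {p} → InInterval a l p → P p → Q p) → countIn P? a l ≤ countIn Q? a l
  countIn-mono Q? a l P⇒Q = intervalSum-mono a l (λ p∈ → 𝟙-mono (P? _) (Q? _) (P⇒Q p∈))

  countIn-disjoint : {Q : Pred ℕ ℓ′} (Q? : Decidable Q) → ∀ a l →
                     (∀ {p} → InInterval a l p → P p → Q p → ⊥) → countIn P? a l + countIn Q? a l ≤ l
  countIn-disjoint Q? a l disj = begin
    countIn P? a l + countIn Q? a l                   ≡⟨ intervalSum-+ _ _ a l ⟨
    intervalSum (λ p → 𝟙 (P? p) + 𝟙 (Q? p)) a l      ≤⟨ intervalSum-mono a l (λ p∈ → 𝟙-disjoint (P? _) (Q? _) (disj p∈)) ⟩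
    intervalSum (λ _ → 1) a l                         ≡⟨ intervalSum-ones a l ⟩
    l                                                 ∎
    where open ≤-Reasoning

  countIn-cover : {Q : Pred ℕ ℓ′} (Q? : Decidable Q) → ∀ a l →
                  (∀ {p} → InInterval a l p → ¬ P p → Q p) → l ≤ countIn P? a l + countIn Q? a l
  countIn-cover Q? a l cover = begin
    l                                                 ≡⟨ intervalSum-ones a l ⟨
    intervalSum (λ _ → 1) a l                         ≤⟨ intervalSum-mono a l (λ p∈ → 𝟙-cover (P? _) (Q? _) (cover p∈)) ⟩
    intervalSum (λ p → 𝟙 (P? p) + 𝟙 (Q? p)) a l      ≡⟨ intervalSum-+ _ _ a l ⟩
    countIn P? a l + countIn Q? a l                   ∎
    where open ≤-Reasoning

  countIn-except : {Q : Pred ℕ ℓ′} (Q? : Decidable Q) → ∀ a l q →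
                   (∀ {p} → InInterval a l p → p ≢ q → P p → Q p) → countIn P? a l ≤ suc (countIn Q? a l)
  countIn-except Q? a zero    q P⇒Q = z≤n
  countIn-except {Q = Q} Q? a (suc l) q P⇒Q with a ≟ q
  ... | yes refl = +-mono-≤ (𝟙≤1 (P? a)) (≤-trans (countIn-mono Q? (suc a) l later) (m≤n+m _ _))
    where
    later : ∀ {p} → InInterval (suc a) l p → P p → Q p
    later p∈@(a<p , _) = P⇒Q (tail⊆interval p∈) (λ { refl → <-irrefl refl a<p })
  ... | no a≢q = ≤-trans (+-mono-≤ (𝟙-mono (P? a) (Q? a) (P⇒Q (head∈interval a l) a≢q))
                                   (countIn-except Q? (suc a) l q (P⇒Q ∘ tail⊆interval)))
                         (≤-reflexive (+-suc _ _))

module MedianOrder {A : Set} (_⇒_ : A → A → Set) (_⇒?_ : ∀ x y → Dec (x ⇒ y))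
  (tournament : ∀ {x y} → x ≢ y → 𝟙 (x ⇒? y) + 𝟙 (y ⇒? x) ≡ 1) where

  outdegreeIn : A → List A → ℕ
  outdegreeIn x []       = 0
  outdegreeIn x (y ∷ ys) = 𝟙 (x ⇒? y) + outdegreeIn x ys

  forwardArcs : List A → ℕ
  forwardArcs []       = 0
  forwardArcs (x ∷ xs) = outdegreeIn x xs + forwardArcs xs

  crossArcs : List A → List A → ℕ
  crossArcs []       ys = 0
  crossArcs (z ∷ zs) ys = outdegreeIn z ys + crossArcs zs ys

  outdegreeIn-++ : ∀ x ys zs → outdegreeIn x (ys ++ zs) ≡ outdegreeIn x ys + outdegreeIn x zs
  outdegreeIn-++ x []       zs = refl
  outdegreeIn-++ x (y ∷ ys) zs =
    trans (cong (𝟙 (x ⇒? y) +_) (outdegreeIn-++ x ys zs)) (sym (+-assoc (𝟙 (x ⇒? y)) _ _))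

  outdegreeIn-move : ∀ z x B C → outdegreeIn z (B ++ x ∷ C) ≡ outdegreeIn z (x ∷ B ++ C)
  outdegreeIn-move z x B C = begin
    outdegreeIn z (B ++ x ∷ C)                   ≡⟨ outdegreeIn-++ z B (x ∷ C) ⟩
    outdegreeIn z B + (𝟙 (z ⇒? x) + outdegreeIn z C) ≡⟨ swapFront (outdegreeIn z B) (𝟙 (z ⇒? x)) (outdegreeIn z C) ⟩
    𝟙 (z ⇒? x) + (outdegreeIn z B + outdegreeIn z C) ≡⟨ cong (𝟙 (z ⇒? x) +_) (outdegreeIn-++ z B C) ⟨
    outdegreeIn z (x ∷ B ++ C)                   ∎
    where
    open ≡-Reasoning
    swapFront : ∀ a b c → a + (b + c) ≡ b + (a + c)
    swapFront = solve-∀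

  forwardArcs-++ : ∀ zs ys → forwardArcs (zs ++ ys) ≡ forwardArcs zs + crossArcs zs ys + forwardArcs ys
  forwardArcs-++ []       ys = refl
  forwardArcs-++ (z ∷ zs) ys = begin
    outdegreeIn z (zs ++ ys) + forwardArcs (zs ++ ys)
      ≡⟨ cong₂ _+_ (outdegreeIn-++ z zs ys) (forwardArcs-++ zs ys) ⟩
    (outdegreeIn z zs + outdegreeIn z ys) + (forwardArcs zs + crossArcs zs ys + forwardArcs ys)
      ≡⟨ rearrange (outdegreeIn z zs) (outdegreeIn z ys) (forwardArcs zs) _ _ ⟩
    (outdegreeIn z zs + forwardArcs zs) + (outdegreeIn z ys + crossArcs zs ys) + forwardArcs ys ∎
    where
    open ≡-Reasoning
    rearrange : ∀ a b c d e → (a + b) + (c + d + e) ≡ (a + c) + (b + d) + e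
    rearrange = solve-∀

  crossArcs-move : ∀ zs x B C → crossArcs zs (B ++ x ∷ C) ≡ crossArcs zs (x ∷ B ++ C)
  crossArcs-move []       x B C = refl
  crossArcs-move (z ∷ zs) x B C = cong₂ _+_ (outdegreeIn-move z x B C) (crossArcs-move zs x B C)

  -- Moving x behind B flips each arc between x and B between forward and backward, so the
  -- number of forward arcs grows by length B − 2 · outdegreeIn x B.
  forwardArcs-moveBehind : ∀ x B C → All (x ≢_) B →
    forwardArcs (B ++ x ∷ C) + 2 * outdegreeIn x B ≡ forwardArcs (x ∷ B ++ C) + length B
  forwardArcs-moveBehind x []      C _ = refl
  forwardArcs-moveBehind x (b ∷ B) C (x≢b ∷ x∉B) = begin
    (outdegreeIn b (B ++ x ∷ C) + F) + 2 * (v + O)   ≡⟨ cong (λ t → t + F + 2 * (v + O)) (outdegreeIn-move b x B C) ⟩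
    ((u + Ob) + F) + 2 * (v + O)                     ≡⟨ step₁ u v Ob F O ⟩
    (u + v) + v + Ob + (F + 2 * O)                   ≡⟨ cong₂ (λ s t → s + v + Ob + t) (tournament (x≢b ∘ sym)) IH ⟩
    1 + v + Ob + (Ox + Fx + length B)                ≡⟨ step₂ v Ob Ox Fx (length B) ⟩
    (v + Ox) + (Ob + Fx) + suc (length B)            ∎
    where
    open ≡-Reasoning
    u  = 𝟙 (b ⇒? x)
    v  = 𝟙 (x ⇒? b)
    O  = outdegreeIn x B
    Ob = outdegreeIn b (B ++ C)
    Ox = outdegreeIn x (B ++ C)
    F  = forwardArcs (B ++ x ∷ C)
    Fx = forwardArcs (B ++ C)
    IH : F + 2 * O ≡ Ox + Fx + length B
    IH = forwardArcs-moveBehind x B C x∉B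
    step₁ : ∀ u v Ob F O → ((u + Ob) + F) + 2 * (v + O) ≡ (u + v) + v + Ob + (F + 2 * O)
    step₁ = solve-∀
    step₂ : ∀ v Ob Ox Fx k → 1 + v + Ob + (Ox + Fx + k) ≡ (v + Ox) + (Ob + Fx) + suc k
    step₂ = solve-∀

  forwardArcs-moveBehind-< : ∀ pre x B C → All (x ≢_) B → 2 * outdegreeIn x B < length B →
    forwardArcs (pre ++ x ∷ B ++ C) < forwardArcs (pre ++ B ++ x ∷ C)
  forwardArcs-moveBehind-< pre x B C x∉B few = begin-strict
    forwardArcs (pre ++ x ∷ B ++ C)                                  ≡⟨ forwardArcs-++ pre (x ∷ B ++ C) ⟩
    forwardArcs pre + crossArcs pre (x ∷ B ++ C) + forwardArcs (x ∷ B ++ C) <⟨ +-monoʳ-< _ gain ⟩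
    forwardArcs pre + crossArcs pre (x ∷ B ++ C) + forwardArcs (B ++ x ∷ C) ≡⟨ cong (λ t → forwardArcs pre + t + _) (crossArcs-move pre x B C) ⟨
    forwardArcs pre + crossArcs pre (B ++ x ∷ C) + forwardArcs (B ++ x ∷ C) ≡⟨ forwardArcs-++ pre (B ++ x ∷ C) ⟨
    forwardArcs (pre ++ B ++ x ∷ C)                                  ∎
    where
    open ≤-Reasoning
    gain : forwardArcs (x ∷ B ++ C) < forwardArcs (B ++ x ∷ C)
    gain = +-cancelʳ-< (2 * outdegreeIn x B) _ _ (begin-strict
      forwardArcs (x ∷ B ++ C) + 2 * outdegreeIn x B  <⟨ +-monoʳ-< _ few ⟩
      forwardArcs (x ∷ B ++ C) + length B             ≡⟨ forwardArcs-moveBehind x B C x∉B ⟨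
      forwardArcs (B ++ x ∷ C) + 2 * outdegreeIn x B  ∎)

  outdegreeIn≤length : ∀ x ys → outdegreeIn x ys ≤ length ys
  outdegreeIn≤length x []       = z≤n
  outdegreeIn≤length x (y ∷ ys) = +-mono-≤ (𝟙≤1 (x ⇒? y)) (outdegreeIn≤length x ys)

  forwardArcs≤length² : ∀ xs → forwardArcs xs ≤ length xs * length xs
  forwardArcs≤length² []       = z≤n
  forwardArcs≤length² (x ∷ xs) =
    +-mono-≤ (m≤n⇒m≤1+n (outdegreeIn≤length x xs))
             (≤-trans (forwardArcs≤length² xs) (*-monoʳ-≤ (length xs) (n≤1+n (length xs))))

  open import Data.List.Relation.Binary.Permutation.Setoid.Properties (setoid A) using (Unique-resp-↭)

  unique-↭ : ∀ {xs ys} → ys ↭ xs → Unique xs → Unique ys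
  unique-↭ ys↭xs = Unique-resp-↭ (↭⇒↭ₛ (↭-sym ys↭xs))

  unique-suffix : ∀ pre {ys : List A} → Unique (pre ++ ys) → Unique ys
  unique-suffix []        u       = u
  unique-suffix (_ ∷ pre) (_ ∷ u) = unique-suffix pre u

  -- Positions at or beyond the end of a list read as default; only positions below the length are used.
  module _ (default : A) where

    at : List A → ℕ → A
    at []       p       = default
    at (x ∷ xs) zero    = x
    at (x ∷ xs) (suc p) = at xs p

    dominatedAfter : List A → ℕ → ℕ → ℕ
    dominatedAfter xs s = countIn (λ p → at xs s ⇒? at xs p) (suc s)

    IsLocalMedianOrder : List A → Set
    IsLocalMedianOrder xs = ∀ s l → s + suc l ≤ length xs → l ≤ 2 * dominatedAfter xs s l

    Violation : List A → ℕ → ℕ → Set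
    Violation xs s l = s + suc l ≤ length xs × 2 * dominatedAfter xs s l < l

    at-split : ∀ xs {s} → s < length xs → xs ≡ take s xs ++ at xs s ∷ drop (suc s) xs
    at-split (x ∷ xs) {zero}  _   = refl
    at-split (x ∷ xs) {suc s} s<∣xs∣ = cong (x ∷_) (at-split xs (≤-pred s<∣xs∣))

    countIn-at : ∀ x xs t l → t + l ≤ length xs →
                 countIn (λ p → x ⇒? at xs p) t l ≡ outdegreeIn x (take l (drop t xs))
    countIn-at x xs       zero    zero    _ = refl
    countIn-at x (y ∷ ys) zero    (suc l) ≤∣xs∣ =
      cong (𝟙 (x ⇒? y) +_) (trans (intervalSum-shift _ 0 l) (countIn-at x ys zero l (≤-pred ≤∣xs∣)))
    countIn-at x (y ∷ ys) (suc t) l       ≤∣xs∣ =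
      trans (intervalSum-shift _ t l) (countIn-at x ys t l (≤-pred ≤∣xs∣))

    length-window : ∀ (xs : List A) t l → t + l ≤ length xs → length (take l (drop t xs)) ≡ l
    length-window xs       zero    zero    _ = refl
    length-window (y ∷ ys) zero    (suc l) ≤∣xs∣ = cong suc (length-window ys zero l (≤-pred ≤∣xs∣))
    length-window (y ∷ ys) (suc t) l       ≤∣xs∣ = length-window ys t l (≤-pred ≤∣xs∣)

    at-All : ∀ {P : Pred A ℓ} {xs} → All P xs → ∀ {p} → p < length xs → P (at xs p)
    at-All (px ∷ _)   {zero}  _      = px
    at-All (_  ∷ pxs) {suc p} p<∣xs∣ = at-All pxs (≤-pred p<∣xs∣)

    at-injective : ∀ {xs} → Unique xs → ∀ {p q} → p < length xs → q < length xs → at xs p ≡ at xs q → p ≡ q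
    at-injective {_ ∷ _} _          {zero}  {zero}  _  _  _  = refl
    at-injective {_ ∷ _} (x∉xs ∷ _) {zero}  {suc q} _  q< eq = ⊥-elim (at-All x∉xs (≤-pred q<) eq)
    at-injective {_ ∷ _} (x∉xs ∷ _) {suc p} {zero}  p< _  eq = ⊥-elim (at-All x∉xs (≤-pred p<) (sym eq))
    at-injective {_ ∷ _} (_ ∷ u)    {suc p} {suc q} p< q< eq = cong suc (at-injective u (≤-pred p<) (≤-pred q<) eq)

    localMedian⊎violation : ∀ xs → IsLocalMedianOrder xs ⊎ ∃ λ s → ∃ (Violation xs s)
    localMedian⊎violation xs with anyUpTo? (λ s → anyUpTo? (violation? s) (length xs)) (length xs)
      where
      violation? : ∀ s l → Dec (Violation xs s l)
      violation? s l = (s + suc l ≤? length xs) ×-dec (2 * dominatedAfter xs s l <? l)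
    ... | yes (s , _ , l , _ , violation) = inj₂ (s , l , violation)
    ... | no none = inj₁ λ s l fits → ≮⇒≥ λ few →
      none (s , s<∣xs∣ fits , l , l<∣xs∣ fits , fits , few)
      where
      s<∣xs∣ : ∀ {s l} → s + suc l ≤ length xs → s < length xs
      s<∣xs∣ {s} {l} fits = ≤-trans (s≤s (m≤m+n s l)) (≤-trans (≤-reflexive (sym (+-suc s l))) fits)
      l<∣xs∣ : ∀ {s l} → s + suc l ≤ length xs → l < length xs
      l<∣xs∣ {s} {l} fits = ≤-trans (m≤n+m (suc l) s) fits

    improve : ∀ {xs} → Unique xs → ∀ {s l} → Violation xs s l →
              ∃ λ ys → ys ↭ xs × forwardArcs xs < forwardArcs ys
    improve {xs} u {s} {l} (fits , few) =
      pre ++ B ++ x ∷ C ,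
      subst (pre ++ B ++ x ∷ C ↭_) (sym xs≡) (++⁺ˡ pre (shift x B C)) ,
      subst (λ zs → forwardArcs zs < forwardArcs (pre ++ B ++ x ∷ C)) (sym xs≡)
            (forwardArcs-moveBehind-< pre x B C x∉B few′)
      where
      pre = take s xs
      x   = at xs s
      B   = take l (drop (suc s) xs)
      C   = drop l (drop (suc s) xs)
      fits′ : suc s + l ≤ length xs
      fits′ = subst (_≤ length xs) (+-suc s l) fits
      xs≡ : xs ≡ pre ++ x ∷ B ++ C
      xs≡ = trans (at-split xs (≤-trans (s≤s (m≤m+n s l)) fits′))
                  (cong (λ zs → pre ++ x ∷ zs) (sym (take++drop≡id l (drop (suc s) xs))))
      x∉B : All (x ≢_) B
      x∉B with unique-suffix pre (subst Unique xs≡ u)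
      ... | x∉B++C ∷ _ = AllP.++⁻ˡ B x∉B++C
      few′ : 2 * outdegreeIn x B < length B
      few′ = subst₂ (λ d k → 2 * d < k) (countIn-at x xs (suc s) l fits′)
                    (sym (length-window xs (suc s) l fits′)) few

    improveUntilLocalMedian : ∀ fuel xs → Unique xs → length xs * length xs < forwardArcs xs + fuel →
                              ∃ λ ys → ys ↭ xs × IsLocalMedianOrder ys
    improveUntilLocalMedian zero xs u short =
      ⊥-elim (<⇒≱ short (≤-trans (≤-reflexive (+-identityʳ _)) (forwardArcs≤length² xs)))
    improveUntilLocalMedian (suc fuel) xs u short with localMedian⊎violation xs
    ... | inj₁ median = xs , ↭-refl , median
    ... | inj₂ (_ , _ , violation) =
      let ys , ys↭xs , gain = improve u violation
          ∣ys∣≡∣xs∣ = ↭-length ys↭xs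
          short′ = subst (λ k → k * k < forwardArcs ys + fuel) (sym ∣ys∣≡∣xs∣)
                     (≤-trans short (≤-trans (≤-reflexive (+-suc _ fuel)) (+-monoˡ-≤ fuel gain)))
          zs , zs↭ys , median = improveUntilLocalMedian fuel ys (unique-↭ ys↭xs u) short′
      in zs , ↭-trans zs↭ys ys↭xs , median

    localMedianOrder : ∀ xs → Unique xs → ∃ λ ys → ys ↭ xs × IsLocalMedianOrder ys
    localMedianOrder xs u = improveUntilLocalMedian (suc (length xs * length xs)) xs u (m≤n+m _ _)

-- parent r is junk (the root has no parent), which is why IsChild excludes the root.
module RootedTree {n : ℕ} (r : Fin n) (parent : Fin n → Fin n) where

  IsChild : Fin n → Fin n → Set
  IsChild w c = c ≢ r × parent c ≡ w

  isChild? : ∀ w c → Dec (IsChild w c)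
  isChild? w c = ¬? (c ≟ᶠ r) ×-dec (parent c ≟ᶠ w)

  Childless : Fin n → Set
  Childless w = ∀ c → ¬ IsChild w c

  childless? : ∀ w → Dec (Childless w)
  childless? w = all? (λ c → ¬? (isChild? w c))

  childlessCount : ℕ
  childlessCount = count childless?

  ancestor : ℕ → Fin n → Fin n
  ancestor zero    v = v
  ancestor (suc t) v = ancestor t (parent v)

  ReachesRoot : Set
  ReachesRoot = ∀ v → ∃ λ t → ancestor t v ≡ r

  module _ (reachesRoot : ReachesRoot) where

    private
      leastRootDistance : ∀ v → ∃ λ t → ancestor t v ≡ r × (∀ {t′} → ancestor t′ v ≡ r → t ≤ t′)
      leastRootDistance v = leastWitness (λ t → ancestor t v ≟ᶠ r) {proj₁ (reachesRoot v)} (proj₂ (reachesRoot v))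

    depth : Fin n → ℕ
    depth v = proj₁ (leastRootDistance v)

    depth-child : ∀ {w c} → IsChild w c → depth w < depth c
    depth-child {w} {c} (c≢r , refl) with leastRootDistance c
    ... | zero  , c≡r , _ = ⊥-elim (c≢r c≡r)
    ... | suc t , reach , _ = s≤s (proj₂ (proj₂ (leastRootDistance w)) reach)

    childless-in-closed : {U : Pred (Fin n) ℓ} → Decidable U → (∀ {w c} → U w → IsChild w c → U c) →
                  ∃ U → ∃ λ w → U w × Childless w
    childless-in-closed U? closed inhabited with argmax U? depth inhabited
    ... | w , uw , deepest = w , uw , λ c w→c → <⇒≱ (depth-child w→c) (deepest (closed uw w→c))

    childlessCount-pos : 1 ≤ childlessCount
    childlessCount-pos with childless-in-closed {U = λ _ → ⊤} (λ _ → yes tt) (λ _ _ → tt) (r , tt)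
    ... | w , _ , childless = count-pos childless? childless

    2≤n+childlessCount : 2 ≤ n + childlessCount
    2≤n+childlessCount = +-mono-≤ (≤-trans (s≤s z≤n) (toℕ<n r)) childlessCount-pos

module GreedyEmbedding {n : ℕ} (r : Fin n) (parent : Fin n → Fin n)
  (_▷_ : ℕ → ℕ → Set) (_▷?_ : ∀ p q → Dec (p ▷ q)) (L : ℕ)
  (localMedian : ∀ s l → s + suc l ≤ L → l ≤ 2 * countIn (s ▷?_) (suc s) l)
  where

  open RootedTree r parent

  Placement : Set
  Placement = Fin n → Maybe ℕ

  Before : Maybe ℕ → ℕ → Set
  Before nothing  t = ⊥
  Before (just p) t = p < t

  before? : ∀ m t → Dec (Before m t)
  before? nothing  t = no λ ()
  before? (just p) t = p <? t

  before-just : ∀ {m t} → Before m t → ∃ λ p → m ≡ just p × p < t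
  before-just {just p} p<t = p , refl , p<t

  before-mono : ∀ {m t t′} → t ≤ t′ → Before m t → Before m t′
  before-mono {just p} t≤t′ p<t = ≤-trans p<t t≤t′

  PlacedBefore : Placement → Fin n → ℕ → Set
  PlacedBefore pos w = Before (pos w)

  Active : Placement → Fin n → ℕ → Set
  Active pos w t = ∃ λ c → IsChild w c × ¬ PlacedBefore pos c t

  active? : ∀ pos w t → Dec (Active pos w t)
  active? pos w t = any? (λ c → isChild? w c ×-dec ¬? (before? (pos c) t))

  active-antitone : ∀ {pos w t t′} → t ≤ t′ → Active pos w t′ → Active pos w t
  active-antitone t≤t′ (c , w→c , unplaced) = c , w→c , unplaced ∘ before-mono t≤t′

  -- The state after positions 0, …, i − 1 have been processed; pos w ≡ just p places w at
  -- position p. The last two fields record the greedy rule: a position is left free only if no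
  -- placed vertex with an unplaced child dominates it, and otherwise receives a child of the
  -- earliest placed such vertex.
  record GreedyState (i : ℕ) : Set where
    field
      pos              : Placement
      root-at-0        : pos r ≡ just 0
      placed-<         : ∀ {w p} → pos w ≡ just p → p < i
      pos-injective    : ∀ {w w′ p} → pos w ≡ just p → pos w′ ≡ just p → w ≡ w′
      parent-dominates : ∀ {c p} → c ≢ r → pos c ≡ just p →
                         ∃ λ q → pos (parent c) ≡ just q × q < p × q ▷ p
      free-undominated : ∀ {p} → p < i → (∀ w → pos w ≢ just p) →
                         ∀ {w q} → pos w ≡ just q → q < p → Active pos w p → ¬ q ▷ p
      earliest-parent  : ∀ {c p q} → c ≢ r → pos c ≡ just p → pos (parent c) ≡ just q →
                         ∀ {w q′} → pos w ≡ just q′ → q′ < q → Active pos w p → ¬ q′ ▷ p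

  initialState : GreedyState 1
  initialState = record
    { pos              = pos₀
    ; root-at-0        = pos₀-r
    ; placed-<         = λ e → s≤s (≤-reflexive (proj₂ (pos₀-just e)))
    ; pos-injective    = λ e e′ → trans (proj₁ (pos₀-just e)) (sym (proj₁ (pos₀-just e′)))
    ; parent-dominates = λ c≢r e → ⊥-elim (c≢r (proj₁ (pos₀-just e)))
    ; free-undominated = λ p<1 free → ⊥-elim (free r (trans pos₀-r (cong just (sym (n<1⇒n≡0 p<1)))))
    ; earliest-parent  = λ c≢r e → ⊥-elim (c≢r (proj₁ (pos₀-just e)))
    }
    where
    pos₀ : Placement
    pos₀ w with w ≟ᶠ r
    ... | yes _ = just 0
    ... | no _  = nothing

    pos₀-r : pos₀ r ≡ just 0
    pos₀-r with r ≟ᶠ r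
    ... | yes _   = refl
    ... | no r≢r  = ⊥-elim (r≢r refl)

    pos₀-just : ∀ {w p} → pos₀ w ≡ just p → w ≡ r × p ≡ 0
    pos₀-just {w} e with w ≟ᶠ r
    pos₀-just refl | yes w≡r = w≡r , refl
    pos₀-just ()   | no _

  _▷ᴹ_ : Maybe ℕ → ℕ → Set
  nothing ▷ᴹ p = ⊥
  just q  ▷ᴹ p = q ▷ p

  _▷ᴹ?_ : ∀ m p → Dec (m ▷ᴹ p)
  nothing ▷ᴹ? p = no λ ()
  just q  ▷ᴹ? p = q ▷? p

  ▷ᴹ-just : ∀ m {p} → m ▷ᴹ p → ∃ λ q → m ≡ just q × q ▷ p
  ▷ᴹ-just (just q) q▷p = q , refl , q▷p

  module Step {i : ℕ} (state : GreedyState i) where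
    open GreedyState state

    Candidate : Fin n → Set
    Candidate w = pos w ▷ᴹ i × Active pos w i

    candidate? : ∀ w → Dec (Candidate w)
    candidate? w = (pos w ▷ᴹ? i) ×-dec active? pos w i

    leaveFree : (∀ w → ¬ Candidate w) → GreedyState (suc i)
    leaveFree none = record
      { pos              = pos
      ; root-at-0        = root-at-0
      ; placed-<         = m≤n⇒m≤1+n ∘ placed-<
      ; pos-injective    = pos-injective
      ; parent-dominates = parent-dominates
      ; free-undominated = free-undominated′
      ; earliest-parent  = earliest-parent
      }
      where
      free-undominated′ : ∀ {p} → p < suc i → (∀ w → pos w ≢ just p) →
                          ∀ {w q} → pos w ≡ just q → q < p → Active pos w p → ¬ q ▷ p
      free-undominated′ p<1+i free e q<p active with m≤n⇒m<n∨m≡n (≤-pred p<1+i)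
      ... | inj₁ p<i  = free-undominated p<i free e q<p active
      ... | inj₂ refl = λ q▷i → none _ (subst (_▷ᴹ i) (sym e) q▷i , active)

    module Place {w : Fin n} (candidate : Candidate w)
                 (earliest : ∀ {w′} → Candidate w′ → fromMaybe 0 (pos w) ≤ fromMaybe 0 (pos w′)) where

      c : Fin n
      c = proj₁ (proj₂ candidate)

      w→c : IsChild w c
      w→c = proj₁ (proj₂ (proj₂ candidate))

      w-dominates : ∃ λ q → pos w ≡ just q × q ▷ i
      w-dominates = ▷ᴹ-just (pos w) (proj₁ candidate)

      q₀ : ℕ
      q₀ = proj₁ w-dominates

      pos-w : pos w ≡ just q₀
      pos-w = proj₁ (proj₂ w-dominates)

      q₀▷i : q₀ ▷ i
      q₀▷i = proj₂ (proj₂ w-dominates)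

      pos-c : pos c ≡ nothing
      pos-c with pos c in e
      ... | nothing = refl
      ... | just p  = ⊥-elim (proj₂ (proj₂ (proj₂ candidate)) (subst (λ m → Before m i) (sym e) (placed-< e)))

      placed≢c : ∀ {x p} → pos x ≡ just p → x ≢ c
      placed≢c e refl with trans (sym e) pos-c
      ... | ()

      pos′ : Placement
      pos′ x with x ≟ᶠ c
      ... | yes _ = just i
      ... | no _  = pos x

      pos′-c : pos′ c ≡ just i
      pos′-c with c ≟ᶠ c
      ... | yes _   = refl
      ... | no c≢c  = ⊥-elim (c≢c refl)

      pos′-just : ∀ {x p} → pos′ x ≡ just p → (x ≡ c × p ≡ i) ⊎ (pos x ≡ just p)
      pos′-just {x} e with x ≟ᶠ c
      ... | yes x≡c = inj₁ (x≡c , sym (just-injective e))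
      ... | no _    = inj₂ e

      pos′-extends : ∀ {x p} → pos x ≡ just p → pos′ x ≡ just p
      pos′-extends {x} e with x ≟ᶠ c
      ... | yes x≡c = ⊥-elim (placed≢c e x≡c)
      ... | no _    = e

      pos′-old : ∀ {x p} → pos′ x ≡ just p → p < i → pos x ≡ just p
      pos′-old {x} e p<i with pos′-just {x} e
      ... | inj₁ (_ , refl) = ⊥-elim (<-irrefl refl p<i)
      ... | inj₂ e′         = e′

      placedBefore-extends : ∀ {x t} → PlacedBefore pos x t → PlacedBefore pos′ x t
      placedBefore-extends {x} {t} placed with before-just placed
      ... | p , e , p<t = subst (λ m → Before m t) (sym (pos′-extends e)) p<t

      active-shrinks : ∀ {x t} → Active pos′ x t → Active pos x t
      active-shrinks (c′ , x→c′ , unplaced) = c′ , x→c′ , unplaced ∘ placedBefore-extends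

      c≢r : c ≢ r
      c≢r = proj₁ w→c

      pos′-parent-c : pos′ (parent c) ≡ just q₀
      pos′-parent-c = pos′-extends (subst (λ y → pos y ≡ just q₀) (sym (proj₂ w→c)) pos-w)

      placed-<′ : ∀ {x p} → pos′ x ≡ just p → p < suc i
      placed-<′ {x} e with pos′-just {x} e
      ... | inj₁ (_ , refl) = ≤-refl
      ... | inj₂ e′         = m≤n⇒m≤1+n (placed-< e′)

      pos-injective′ : ∀ {x y p} → pos′ x ≡ just p → pos′ y ≡ just p → x ≡ y
      pos-injective′ {x} {y} ex ey with pos′-just {x} ex | pos′-just {y} ey
      ... | inj₁ (x≡c , _)  | inj₁ (y≡c , _)  = trans x≡c (sym y≡c)
      ... | inj₁ (_ , refl) | inj₂ ey′        = ⊥-elim (<-irrefl refl (placed-< ey′))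
      ... | inj₂ ex′        | inj₁ (_ , refl) = ⊥-elim (<-irrefl refl (placed-< ex′))
      ... | inj₂ ex′        | inj₂ ey′        = pos-injective ex′ ey′

      parent-dominates′ : ∀ {x p} → x ≢ r → pos′ x ≡ just p →
                          ∃ λ q → pos′ (parent x) ≡ just q × q < p × q ▷ p
      parent-dominates′ {x} x≢r e with pos′-just {x} e
      ... | inj₁ (refl , refl) = q₀ , pos′-parent-c , placed-< pos-w , q₀▷i
      ... | inj₂ e′ with parent-dominates x≢r e′
      ...   | q , e-parent , q<p , q▷p = q , pos′-extends e-parent , q<p , q▷p

      free-undominated′ : ∀ {p} → p < suc i → (∀ x → pos′ x ≢ just p) →
                          ∀ {x q} → pos′ x ≡ just q → q < p → Active pos′ x p → ¬ q ▷ p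
      free-undominated′ p<1+i free e q<p active with m≤n⇒m<n∨m≡n (≤-pred p<1+i)
      ... | inj₂ refl = ⊥-elim (free c pos′-c)
      ... | inj₁ p<i  = free-undominated p<i (λ y → free y ∘ pos′-extends)
                          (pos′-old e (<-trans q<p p<i)) q<p (active-shrinks active)

      earliest-parent′ : ∀ {x p q} → x ≢ r → pos′ x ≡ just p → pos′ (parent x) ≡ just q →
                         ∀ {y q′} → pos′ y ≡ just q′ → q′ < q → Active pos′ y p → ¬ q′ ▷ p
      earliest-parent′ {x} x≢r ex e-parent {q′ = q′} ey q′<q active with pos′-just {x} ex
      ... | inj₂ ex′ =
        let q₁ , e-parent₁ , q₁<p , _ = parent-dominates x≢r ex′
            q₁≡q = just-injective (trans (sym (pos′-extends e-parent₁)) e-parent)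
            q<i  = <-trans (subst (_< _) q₁≡q q₁<p) (placed-< ex′)
        in earliest-parent x≢r ex′ (pos′-old e-parent q<i) (pos′-old ey (<-trans q′<q q<i)) q′<q
                           (active-shrinks active)
      ... | inj₁ (refl , refl) = λ q′▷i →
        let q≡q₀ = just-injective (trans (sym e-parent) pos′-parent-c)
            ey′  = pos′-old ey (<-trans q′<q (subst (_< i) (sym q≡q₀) (placed-< pos-w)))
            q₀≤q′ = subst₂ _≤_ (cong (fromMaybe 0) pos-w) (cong (fromMaybe 0) ey′)
                      (earliest (subst (_▷ᴹ i) (sym ey′) q′▷i , active-shrinks active))
        in <⇒≱ (subst (q′ <_) q≡q₀ q′<q) q₀≤q′

      placeChild : GreedyState (suc i)
      placeChild = record
        { pos              = pos′
        ; root-at-0        = pos′-extends root-at-0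
        ; placed-<         = λ {x} → placed-<′ {x}
        ; pos-injective    = λ {x} {y} → pos-injective′ {x} {y}
        ; parent-dominates = λ {x} → parent-dominates′ {x}
        ; free-undominated = free-undominated′
        ; earliest-parent  = λ {x} → earliest-parent′ {x}
        }

    step : GreedyState (suc i)
    step with any? candidate?
    ... | no none = leaveFree (λ w candidate → none (w , candidate))
    ... | yes some with argmin candidate? (fromMaybe 0 ∘ pos) some
    ...   | w , candidate , earliest = Place.placeChild candidate earliest

  greedy : ∀ i → GreedyState (suc i)
  greedy zero    = initialState
  greedy (suc i) = Step.step (greedy i)

  module Counting {i : ℕ} (state : GreedyState i) where
    open GreedyState state

    OccupiedBy : Pred (Fin n) ℓ → ℕ → Set ℓ
    OccupiedBy Q p = ∃ λ w → pos w ≡ just p × Q w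

    occupiedBy? : {Q : Pred (Fin n) ℓ} → Decidable Q → Decidable (OccupiedBy Q)
    occupiedBy? Q? p = any? (λ w → ≡-decᴹ _≟_ (pos w) (just p) ×-dec Q? w)

    Occupied : ℕ → Set
    Occupied = OccupiedBy (λ _ → ⊤)

    occupied? : Decidable Occupied
    occupied? = occupiedBy? (λ _ → yes tt)

    Free : ℕ → Set
    Free p = ¬ Occupied p

    free? : Decidable Free
    free? = ¬? ∘ occupied?

    -- The vertices placed at positions ≥ a form a forest; these are its roots.
    IsForestRoot : ℕ → Fin n → Set
    IsForestRoot a w = w ≡ r ⊎ PlacedBefore pos (parent w) a

    PlacedIn : ℕ → ℕ → Fin n → Set
    PlacedIn a b c = ∃ λ q → pos c ≡ just q × a ≤ q × q < b

    placedIn? : ∀ a b c → Dec (PlacedIn a b c)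
    placedIn? a b c with pos c
    ... | nothing = no λ ()
    ... | just q  with (a ≤? q) ×-dec (q <? b)
    ...   | yes (a≤q , q<b) = yes (q , refl , a≤q , q<b)
    ...   | no  ¬in          = no λ { (_ , refl , in′) → ¬in in′ }

    NoChildIn : ℕ → ℕ → Fin n → Set
    NoChildIn a b u = ∀ c → IsChild u c → ¬ PlacedIn a b c

    root? : ∀ a → Decidable (OccupiedBy (IsForestRoot a))
    root? a = occupiedBy? (λ w → (w ≟ᶠ r) ⊎-dec before? (pos (parent w)) a)

    leaf? : ∀ a b → Decidable (OccupiedBy (NoChildIn a b))
    leaf? a b = occupiedBy? (λ u → all? (λ c → isChild? u c →-dec ¬? (placedIn? a b c)))

    pos-functional : ∀ {w p p′} → pos w ≡ just p → pos w ≡ just p′ → p ≡ p′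
    pos-functional e e′ = just-injective (trans (sym e) e′)

    newest-leaf : ∀ a {b} → Occupied b → OccupiedBy (NoChildIn a (suc b)) b
    newest-leaf a {b} (w , e , _) = w , e , λ c w→c (q , ec , _ , q<1+b) →
      let q′ , e′ , q′<q , _ = parent-dominates (proj₁ w→c) ec
          q′≡b = pos-functional (subst (λ z → pos z ≡ just q′) (proj₂ w→c) e′) e
      in <⇒≱ (subst (_< q) q′≡b q′<q) (≤-pred q<1+b)

    noChildIn-extend : ∀ {a b u} → (∀ {c} → pos c ≡ just b → ¬ IsChild u c) →
                       NoChildIn a b u → NoChildIn a (suc b) u
    noChildIn-extend notAtB none c u→c (q , ec , a≤q , q<1+b) with m≤n⇒m<n∨m≡n (≤-pred q<1+b)
    ... | inj₁ q<b  = none c u→c (q , ec , a≤q , q<b)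
    ... | inj₂ refl = notAtB ec u→c

    leaf-extend : ∀ {a b p} → (∀ {u c} → pos u ≡ just p → pos c ≡ just b → ¬ IsChild u c) →
                  OccupiedBy (NoChildIn a b) p → OccupiedBy (NoChildIn a (suc b)) p
    leaf-extend notParent (u , eu , none) = u , eu , noChildIn-extend (notParent eu) none

    leafGain : ∀ a l →
      countIn (leaf? a (a + l)) a l + 𝟙 (root? a (a + l)) ≤
      countIn (leaf? a (suc (a + l))) a l + 𝟙 (leaf? a (suc (a + l)) (a + l))
    leafGain a l with occupied? (a + l)
    ... | no free =
      +-mono-≤ (countIn-mono (leaf? a b) (leaf? a (suc b)) a l (λ _ → leaf-extend λ _ ec _ → free (_ , ec , tt)))
               (𝟙-mono (root? a b) (leaf? a (suc b) b) λ (w , e , _) → ⊥-elim (free (w , e , tt)))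
      where b = a + l
    ... | yes occupied with root? a (a + l)
    ...   | yes (w , ew , isRoot) =
      +-mono-≤ (countIn-mono (leaf? a b) (leaf? a (suc b)) a l (λ (a≤p , _) → leaf-extend (rootNotChild a≤p)))
               (≤-reflexive (sym (𝟙-yes (leaf? a (suc b) b) (newest-leaf a occupied))))
      where
      b = a + l
      rootNotChild : ∀ {p u c} → a ≤ p → pos u ≡ just p → pos c ≡ just b → ¬ IsChild u c
      rootNotChild a≤p eu ec (c≢r , refl) with pos-injective ew ec
      ... | refl = notRoot isRoot
        where
        notRoot : ¬ IsForestRoot a w
        notRoot (inj₁ w≡r)   = c≢r w≡r
        notRoot (inj₂ before) = <⇒≱ (subst (λ m → Before m a) eu before) a≤p
    ...   | no notRoot = begin
      countIn (leaf? a b) a l + 0                    ≡⟨ +-identityʳ _ ⟩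
      countIn (leaf? a b) a l                        ≤⟨ countIn-except (leaf? a b) (leaf? a (suc b)) a l q exceptParent ⟩
      suc (countIn (leaf? a (suc b)) a l)            ≡⟨ +-comm 1 _ ⟩
      countIn (leaf? a (suc b)) a l + 1              ≡⟨ cong (countIn (leaf? a (suc b)) a l +_) (𝟙-yes (leaf? a (suc b) b) (newest-leaf a occupied)) ⟨
      countIn (leaf? a (suc b)) a l + 𝟙 (leaf? a (suc b) b) ∎
      where
      open ≤-Reasoning
      b = a + l
      w  = proj₁ occupied
      ew = proj₁ (proj₂ occupied)
      w≢r : w ≢ r
      w≢r w≡r = notRoot (w , ew , inj₁ w≡r)
      parent-w = parent-dominates w≢r ew
      q = proj₁ parent-w
      exceptParent : ∀ {p} → InInterval a l p → p ≢ q → OccupiedBy (NoChildIn a b) p → OccupiedBy (NoChildIn a (suc b)) p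
      exceptParent _ p≢q = leaf-extend λ eu ec (_ , parent-c≡u) →
        p≢q (pos-functional eu (subst (λ z → pos z ≡ just q) (trans (cong parent (pos-injective ew ec)) parent-c≡u)
                                                                 (proj₁ (proj₂ parent-w))))
        
    roots≤leaves : ∀ a l → countIn (root? a) a l ≤ countIn (leaf? a (a + l)) a l
    roots≤leaves a zero    = z≤n
    roots≤leaves a (suc l) = begin
      countIn (root? a) a (suc l)                                     ≡⟨ intervalSum-snoc _ a l ⟩
      countIn (root? a) a l + 𝟙 (root? a (a + l))                     ≤⟨ +-monoˡ-≤ _ (roots≤leaves a l) ⟩
      countIn (leaf? a (a + l)) a l + 𝟙 (root? a (a + l))             ≤⟨ leafGain a l ⟩
      countIn (leaf? a (suc (a + l))) a l + 𝟙 (leaf? a (suc (a + l)) (a + l)) ≡⟨ intervalSum-snoc _ a l ⟨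
      countIn (leaf? a (suc (a + l))) a (suc l)                       ≡⟨ cong (λ b → countIn (leaf? a b) a (suc l)) (+-suc a l) ⟨
      countIn (leaf? a (a + suc l)) a (suc l)                         ∎
      where open ≤-Reasoning

    childlessOccupied? : Decidable (OccupiedBy Childless)
    childlessOccupied? = occupiedBy? childless?

    PlacedActive : ℕ → Fin n → Set
    PlacedActive t w = PlacedBefore pos w t × Active pos w t

    placedActive? : ∀ t → Decidable (PlacedActive t)
    placedActive? t w = before? (pos w) t ×-dec active? pos w t

    -- a, placed at j, is the latest placed vertex still active at j + 1 + l. On (j, j + l] the
    -- positions a dominates are roots of the forest above j, free positions are not dominated
    -- by a, and the leaves of that forest are childless; the median property at j finishes.
    module LatestActive {j l : ℕ} (j+1+l≤i : j + suc l ≤ i) (i≤L : i ≤ L) {a : Fin n} (pos-a : pos a ≡ just j)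
      (a-active : Active pos a (j + suc l))
      (latest : ∀ {w} → PlacedActive (j + suc l) w → fromMaybe 0 (pos w) ≤ j) where

      within : ∀ {p} → InInterval (suc j) l p → p < j + suc l
      within {p} (_ , p<) = subst (p <_) (sym (+-suc j l)) p<

      a-active-at : ∀ {p} → InInterval (suc j) l p → Active pos a p
      a-active-at p∈ = active-antitone (<⇒≤ (within p∈)) a-active

      free⇒undominated : ∀ {p} → InInterval (suc j) l p → Free p → ¬ j ▷ p
      free⇒undominated p∈@(j<p , _) free =
        free-undominated (≤-trans (within p∈) j+1+l≤i) (λ w e → free (w , e , tt)) pos-a j<p (a-active-at p∈)

      dominated⇒root : ∀ {p} → InInterval (suc j) l p → j ▷ p → OccupiedBy (IsForestRoot (suc j)) p
      dominated⇒root {p} p∈@(j<p , _) j▷p with occupied? p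
      ... | no free = ⊥-elim (free⇒undominated p∈ free j▷p)
      ... | yes (c , ec , _) = c , ec , root
        where
        c≢r : c ≢ r
        c≢r refl = <⇒≱ j<p (subst (_≤ j) (pos-functional root-at-0 ec) z≤n)
        root : IsForestRoot (suc j) c
        root with parent-dominates c≢r ec
        ... | q , e-parent , _ with q <? suc j
        ...   | yes q≤j = inj₂ (subst (λ m → Before m (suc j)) (sym e-parent) q≤j)
        ...   | no  q≰j = ⊥-elim (earliest-parent c≢r ec e-parent pos-a (≰⇒> (q≰j ∘ s≤s)) (a-active-at p∈) j▷p)

      leaf⇒childless : ∀ {p} → InInterval (suc j) l p → OccupiedBy (NoChildIn (suc j) (suc j + l)) p →
                       OccupiedBy Childless p
      leaf⇒childless {p} p∈@(j<p , _) (u , eu , none) = u , eu , childless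
        where
        childless : Childless u
        childless c u→c with before? (pos c) (j + suc l)
        ... | yes placed =
          let q , ec , q< = before-just placed
              q′ , e-parent , q′<q , _ = parent-dominates (proj₁ u→c) ec
              q′≡p = pos-functional (subst (λ z → pos z ≡ just q′) (proj₂ u→c) e-parent) eu
          in none c u→c (q , ec , ≤-trans j<p (<⇒≤ (subst (_< q) q′≡p q′<q)) , subst (q <_) (+-suc j l) q<)
        ... | no unplaced =
          <⇒≱ j<p (subst (_≤ j) (cong (fromMaybe 0) eu)
                    (latest (subst (λ m → Before m _) (sym eu) (within p∈) , c , u→c , unplaced)))

      free≤dominated : countIn free? (suc j) l ≤ countIn (j ▷?_) (suc j) l
      free≤dominated = +-cancelʳ-≤ D _ D (begin
        countIn free? (suc j) l + D ≤⟨ countIn-disjoint free? (j ▷?_) (suc j) l free⇒undominated ⟩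
        l                           ≤⟨ localMedian j l (≤-trans j+1+l≤i i≤L) ⟩
        2 * D                       ≡⟨ cong (D +_) (+-identityʳ D) ⟩
        D + D                       ∎)
        where
        open ≤-Reasoning
        D = countIn (j ▷?_) (suc j) l

      free≤childless : countIn free? (suc j) l ≤ countIn childlessOccupied? (suc j) l
      free≤childless = begin
        countIn free? (suc j) l                                     ≤⟨ free≤dominated ⟩
        countIn (j ▷?_) (suc j) l                                   ≤⟨ countIn-mono (j ▷?_) (root? (suc j)) (suc j) l dominated⇒root ⟩
        countIn (root? (suc j)) (suc j) l                           ≤⟨ roots≤leaves (suc j) l ⟩
        countIn (leaf? (suc j) (suc j + l)) (suc j) l               ≤⟨ countIn-mono (leaf? (suc j) (suc j + l)) childlessOccupied? (suc j) l leaf⇒childless ⟩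
        countIn childlessOccupied? (suc j) l                        ∎
        where open ≤-Reasoning

      free≤childless-extend : countIn free? 0 j ≤ countIn childlessOccupied? 0 j →
                              countIn free? 0 (j + suc l) ≤ countIn childlessOccupied? 0 (j + suc l)
      free≤childless-extend IH = begin
        countIn free? 0 (j + suc l)                                          ≡⟨ intervalSum-split _ 0 j (suc l) ⟩
        countIn free? 0 j + (𝟙 (free? j) + countIn free? (suc j) l)          ≡⟨ cong (λ k → countIn free? 0 j + (k + countIn free? (suc j) l)) (𝟙-no (free? j) (λ free → free (a , pos-a , tt))) ⟩
        countIn free? 0 j + countIn free? (suc j) l                          ≤⟨ +-mono-≤ IH (≤-trans free≤childless (m≤n+m _ _)) ⟩
        countIn childlessOccupied? 0 j + (𝟙 (childlessOccupied? j) + countIn childlessOccupied? (suc j) l) ≡⟨ intervalSum-split _ 0 j (suc l) ⟨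
        countIn childlessOccupied? 0 (j + suc l)                             ∎
        where open ≤-Reasoning

    module _ (reachesRoot : ReachesRoot) where

      placedActive-exists : ∀ {t} → 1 ≤ t → (∃ λ z → ¬ PlacedBefore pos z t) → ∃ (PlacedActive t)
      placedActive-exists {t} 1≤t (z , unplaced) with reachesRoot z
      ... | k , ancestor≡r = climb k unplaced (subst (λ v → PlacedBefore pos v t) (sym ancestor≡r) root-placed)
        where
        root-placed : PlacedBefore pos r t
        root-placed = subst (λ m → Before m t) (sym root-at-0) 1≤t
        climb : ∀ k {z} → ¬ PlacedBefore pos z t → PlacedBefore pos (ancestor k z) t → ∃ (PlacedActive t)
        climb zero    unplaced placed = ⊥-elim (unplaced placed)
        climb (suc k) {z} unplaced placed with before? (pos (parent z)) t
        ... | yes parent-placed   = parent z , parent-placed , z , (z≢r , refl) , unplaced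
          where
          z≢r : z ≢ r
          z≢r refl = unplaced root-placed
        ... | no  parent-unplaced = climb k parent-unplaced placed

      free≤childless-prefix : i ≤ L → ∀ t → t ≤ i → (∃ λ z → ¬ PlacedBefore pos z t) →
                              countIn free? 0 t ≤ countIn childlessOccupied? 0 t
      free≤childless-prefix i≤L = <-rec Goal step
        where
        Goal : ℕ → Set
        Goal t = t ≤ i → (∃ λ z → ¬ PlacedBefore pos z t) → countIn free? 0 t ≤ countIn childlessOccupied? 0 t
        step : ∀ t → (∀ {s} → s < t → Goal s) → Goal t
        step zero    _  _   _        = z≤n
        step (suc t) IH t≤i unplaced =
          let a , (placed-a , a-active) , latest = argmax (placedActive? (suc t)) (fromMaybe 0 ∘ pos)
                                                     (placedActive-exists (s≤s z≤n) unplaced)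
              j , pos-a , j<t = before-just placed-a
              l , e = m≤n⇒∃[o]m+o≡n j<t
              j+1+l≡t = trans (+-suc j l) e
              z , z-unplaced = unplaced
          in subst (λ t → countIn free? 0 t ≤ countIn childlessOccupied? 0 t) j+1+l≡t
               (LatestActive.free≤childless-extend (subst (_≤ i) (sym j+1+l≡t) t≤i) i≤L pos-a
                  (subst (Active pos a) (sym j+1+l≡t) a-active)
                  (λ {w} placedActive → ≤-trans (latest (subst (λ t → PlacedActive t w) j+1+l≡t placedActive))
                                            (≤-reflexive (cong (fromMaybe 0) pos-a)))
                  (IH j<t (≤-trans (<⇒≤ j<t) t≤i) (z , z-unplaced ∘ before-mono (<⇒≤ j<t))))

    placedCount : {Q : Pred (Fin n) ℓ} → Decidable Q → ℕ → ℕ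
    placedCount Q? t = count (λ w → before? (pos w) t ×-dec Q? w)

    occupiedCount≤placedCount : {Q : Pred (Fin n) ℓ} (Q? : Decidable Q) → ∀ t →
                                countIn (occupiedBy? Q?) 0 t ≤ placedCount Q? t
    occupiedCount≤placedCount Q? zero    = z≤n
    occupiedCount≤placedCount {Q = Q} Q? (suc t) = begin
      countIn (occupiedBy? Q?) 0 (suc t)                   ≡⟨ intervalSum-snoc _ 0 t ⟩
      countIn (occupiedBy? Q?) 0 t + 𝟙 (occupiedBy? Q? t)  ≤⟨ +-mono-≤ (occupiedCount≤placedCount Q? t) (𝟙∃≤count atT? (occupiedBy? Q? t)) ⟩
      placedCount Q? t + count atT?                        ≡⟨ ∑-distrib-+ (λ w → 𝟙 (before? (pos w) t ×-dec Q? w)) (λ w → 𝟙 (atT? w)) ⟨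
      sum (λ w → 𝟙 (before? (pos w) t ×-dec Q? w) + 𝟙 (atT? w)) ≤⟨ sum-mono-≤ (λ w → 𝟙-union _ (atT? w) _ placedEarlier placedAtT (disjoint w)) ⟩
      placedCount Q? (suc t)                               ∎
      where
      open ≤-Reasoning
      atT? : ∀ w → Dec (pos w ≡ just t × Q w)
      atT? w = ≡-decᴹ _≟_ (pos w) (just t) ×-dec Q? w
      placedEarlier : ∀ {w} → PlacedBefore pos w t × Q w → PlacedBefore pos w (suc t) × Q w
      placedEarlier (placed , qw) = before-mono (n≤1+n t) placed , qw
      placedAtT : ∀ {w} → pos w ≡ just t × Q w → PlacedBefore pos w (suc t) × Q w
      placedAtT (e , qw) = subst (λ m → Before m (suc t)) (sym e) ≤-refl , qw
      disjoint : ∀ w → PlacedBefore pos w t × Q w → pos w ≡ just t × Q w → ⊥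
      disjoint w (placed , _) (e , _) = <-irrefl refl (subst (λ m → Before m t) e placed)

    module _ (reachesRoot : ReachesRoot) (i≤L : i ≤ L) (bound : n + childlessCount ≤ suc i) where

      unplaced-impossible : ¬ (∃ λ z → ¬ PlacedBefore pos z i)
      unplaced-impossible unplaced = 1+n≰n (begin
        suc (suc i)                   ≤⟨ s≤s (s≤s (≤-trans cover (+-monoʳ-≤ occupied (free≤childless-prefix reachesRoot i≤L i ≤-refl unplaced)))) ⟩
        suc (suc (occupied + childlessOccupied)) ≡⟨ cong suc (+-suc occupied childlessOccupied) ⟨
        suc occupied + suc childlessOccupied    ≤⟨ +-mono-≤ occupied<n childlessOccupied<childlessCount ⟩
        n + childlessCount            ≤⟨ bound ⟩
        suc i                         ∎)
        where
        open ≤-Reasoning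
        occupied childlessOccupied : ℕ
        occupied          = countIn occupied? 0 i
        childlessOccupied = countIn childlessOccupied? 0 i
        cover : i ≤ occupied + countIn free? 0 i
        cover = countIn-cover occupied? free? 0 i (λ _ free → free)
        unplaced-closed : ∀ {v c} → ¬ PlacedBefore pos v i → IsChild v c → ¬ PlacedBefore pos c i
        unplaced-closed v-unplaced (c≢r , refl) c-placed =
          let p , ec , p<i = before-just c-placed
              q , e-parent , q<p , _ = parent-dominates c≢r ec
          in v-unplaced (subst (λ m → Before m i) (sym e-parent) (<-trans q<p p<i))
        leaf = childless-in-closed reachesRoot (λ v → ¬? (before? (pos v) i)) unplaced-closed unplaced
        z = proj₁ leaf
        z-unplaced = proj₁ (proj₂ leaf)
        occupied<n : occupied < n
        occupied<n = begin-strict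
          occupied                      ≤⟨ occupiedCount≤placedCount {Q = λ _ → ⊤} (λ _ → yes tt) i ⟩
          placedCount {Q = λ _ → ⊤} (λ _ → yes tt) i
            <⟨ count-mono-< _ {Q = λ _ → ⊤} (λ _ → yes tt) (λ _ → tt) {z} tt (z-unplaced ∘ proj₁) ⟩
          count {n} {P = λ _ → ⊤} (λ _ → yes tt) ≡⟨ sum-ones n ⟩
          n                             ∎
        childlessOccupied<childlessCount : childlessOccupied < childlessCount
        childlessOccupied<childlessCount = begin-strict
          childlessOccupied             ≤⟨ occupiedCount≤placedCount childless? i ⟩
          placedCount childless? i      <⟨ count-mono-< _ childless? proj₂ {z} (proj₂ (proj₂ leaf)) (z-unplaced ∘ proj₁) ⟩
          childlessCount                ∎

      everyonePlaced : ∀ z → PlacedBefore pos z i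
      everyonePlaced z with before? (pos z) i
      ... | yes placed   = placed
      ... | no  unplaced = ⊥-elim (unplaced-impossible (z , unplaced))

  greedyAt : ∀ t → 1 ≤ t → GreedyState t
  greedyAt (suc t) _ = greedy t

  embedding : ReachesRoot → n + childlessCount ≤ suc L →
              ∃ λ (f : Fin n → ℕ) → (∀ w → f w < L) × (∀ {w w′} → f w ≡ f w′ → w ≡ w′) ×
                                    (∀ {c} → c ≢ r → f (parent c) ▷ f c)
  embedding reachesRoot bound = f , (λ w → proj₂ (proj₂ (slot w))) , f-injective , f-arcs
    where
    1≤L : 1 ≤ L
    1≤L = ≤-pred (≤-trans (2≤n+childlessCount reachesRoot) bound)
    state : GreedyState L
    state = greedyAt L 1≤L
    open GreedyState state
    open Counting state
    slot : ∀ w → ∃ λ p → pos w ≡ just p × p < L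
    slot w = before-just (everyonePlaced reachesRoot ≤-refl bound w)
    f : Fin n → ℕ
    f w = proj₁ (slot w)
    pos-f : ∀ w → pos w ≡ just (f w)
    pos-f w = proj₁ (proj₂ (slot w))
    f-injective : ∀ {w w′} → f w ≡ f w′ → w ≡ w′
    f-injective {w} {w′} e = pos-injective (pos-f w) (trans (pos-f w′) (cong just (sym e)))
    f-arcs : ∀ {c} → c ≢ r → f (parent c) ▷ f c
    f-arcs {c} c≢r with parent-dominates c≢r (pos-f c)
    ... | q , e-parent , _ , q▷ = subst (_▷ f c) (pos-functional e-parent (pos-f (parent c))) q▷

module TournamentEmbedding {M : ℕ} (T : Tournament M) where
  open Tournament T

  _⇒_ : Fin M → Fin M → Set
  x ⇒ y = Arc arc x y

  _⇒?_ : ∀ x y → Dec (x ⇒ y)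
  x ⇒? y = arc x y ≟ᴮ true

  exactlyOne-𝟙 : ∀ {x y} → x ≢ y → 𝟙 (x ⇒? y) + 𝟙 (y ⇒? x) ≡ 1
  exactlyOne-𝟙 {x} {y} x≢y with arc x y | arc y x | exactlyOne x y x≢y
  ... | true  | true  | differ = ⊥-elim (differ refl)
  ... | true  | false | _      = refl
  ... | false | true  | _      = refl
  ... | false | false | differ = ⊥-elim (differ refl)

  open MedianOrder _⇒_ _⇒?_ exactlyOne-𝟙

  treeEmbedding : ∀ {n} (r : Fin n) (parent : Fin n → Fin n) → RootedTree.ReachesRoot r parent →
                  n + RootedTree.childlessCount r parent ≤ suc M →
                  ∃ λ (f : Fin n → Fin M) → Injective _≡_ _≡_ f × (∀ {c} → c ≢ r → f (parent c) ⇒ f c)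
  treeEmbedding r parent reachesRoot bound = σ ∘ g , σ∘g-injective , g-arcs
    where
    default : Fin M
    default = fromℕ< (≤-pred (≤-trans (RootedTree.2≤n+childlessCount r parent reachesRoot) bound))
    median = localMedianOrder default (allFin M) (allFin⁺ M)
    ys = proj₁ median
    ∣ys∣≡M : length ys ≡ M
    ∣ys∣≡M = trans (↭-length (proj₁ (proj₂ median))) (length-tabulate id)
    σ : ℕ → Fin M
    σ = at default ys
    open GreedyEmbedding r parent (λ p q → σ p ⇒ σ q) (λ p q → σ p ⇒? σ q) M
           (λ s l fits → proj₂ (proj₂ median) s l (subst (s + suc l ≤_) (sym ∣ys∣≡M) fits))
    greedyResult = embedding reachesRoot bound
    g = proj₁ greedyResult
    g<∣ys∣ : ∀ w → g w < length ys
    g<∣ys∣ w = subst (g w <_) (sym ∣ys∣≡M) (proj₁ (proj₂ greedyResult) w)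
    σ∘g-injective : ∀ {w w′} → σ (g w) ≡ σ (g w′) → w ≡ w′
    σ∘g-injective {w} {w′} e = proj₁ (proj₂ (proj₂ greedyResult))
      (at-injective default (unique-↭ (proj₁ (proj₂ median)) (allFin⁺ M)) (g<∣ys∣ w) (g<∣ys∣ w′) e)
    g-arcs : ∀ {c} → c ≢ r → σ (g (parent c)) ⇒ σ (g c)
    g-arcs = proj₂ (proj₂ (proj₂ greedyResult))

length-filter-tabulate : {P : Pred X ℓ} (P? : Decidable P) (g : Fin n → X) →
                         length (filter P? (tabulate g)) ≡ count (P? ∘ g)
length-filter-tabulate {n = zero}  P? g = refl
length-filter-tabulate {n = suc n} P? g with P? (g zero)
... | yes _ = cong suc (length-filter-tabulate P? (g ∘ suc))
... | no _  = length-filter-tabulate P? (g ∘ suc)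

sumᴸ-map-tabulate : (h : X → ℕ) (g : Fin n → X) → sumᴸ (map h (tabulate g)) ≡ sum (h ∘ g)
sumᴸ-map-tabulate {n = zero}  h g = refl
sumᴸ-map-tabulate {n = suc n} h g = cong (h (g zero) +_) (sumᴸ-map-tabulate h (g ∘ suc))

outdegree : Digraph n → Fin n → ℕ
outdegree D u = count (λ v → D u v ≟ᴮ true)

arcCount≡∑outdegree : (D : Digraph n) → arcCount D ≡ sum (outdegree D)
arcCount≡∑outdegree {n} D = trans (sumᴸ-map-tabulate (λ u → length (filter (λ v → D u v ≟ᴮ true) (allFin n))) id) (sum-cong-≗ (λ u → length-filter-tabulate (λ v → D u v ≟ᴮ true) id))

degree≡count : (D : Digraph n) (u : Fin n) → degree D u ≡ count (λ v → adjacent D u v ≟ᴮ true)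
degree≡count D u = length-filter-tabulate (λ v → adjacent D u v ≟ᴮ true) id

leafCount≡count : (D : Digraph n) → leafCount D ≡ count (λ u → degree D u ≤? 1)
leafCount≡count D = length-filter-tabulate (λ u → degree D u ≤? 1) id

arcCount-flip : (D : Digraph n) → arcCount (flip D) ≡ arcCount D
arcCount-flip D = begin
  arcCount (flip D)         ≡⟨ arcCount≡∑outdegree (flip D) ⟩
  sum (outdegree (flip D))  ≡⟨ ∑-comm (λ u v → 𝟙 (D v u ≟ᴮ true)) ⟩
  sum (outdegree D)         ≡⟨ arcCount≡∑outdegree D ⟨
  arcCount D                ∎
  where open ≡-Reasoning

leafCount-flip : (D : Digraph n) → leafCount (flip D) ≡ leafCount D
leafCount-flip D = begin
  leafCount (flip D)                         ≡⟨ leafCount≡count (flip D) ⟩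
  count (λ u → degree (flip D) u ≤? 1)       ≡⟨ sum-cong-≗ (λ u → cong (λ d → 𝟙 (d ≤? 1)) (degree-flip u)) ⟩
  count (λ u → degree D u ≤? 1)              ≡⟨ leafCount≡count D ⟨
  leafCount D                                ∎
  where
  open ≡-Reasoning
  degree-flip : ∀ u → degree (flip D) u ≡ degree D u
  degree-flip u = begin
    degree (flip D) u                          ≡⟨ degree≡count (flip D) u ⟩
    count (λ v → adjacent (flip D) u v ≟ᴮ true) ≡⟨ sum-cong-≗ (λ v → cong (λ b → 𝟙 (b ≟ᴮ true)) (∨-comm (D v u) (D u v))) ⟩
    count (λ v → adjacent D u v ≟ᴮ true)        ≡⟨ degree≡count D u ⟨
    degree D u                                  ∎

module OutArborescence {n : ℕ} {D : Digraph n} {r : Fin n} (out : IsOutArborescence D r) where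
  open RootedTree using (IsChild; Childless; ReachesRoot; ancestor; childless?; childlessCount)

  indegree : Fin n → ℕ
  indegree v = count (λ u → D u v ≟ᴮ true)

  nonRoot : Fin n → ℕ
  nonRoot v = 𝟙 (¬? (v ≟ᶠ r))

  ∑nonRoot : sum nonRoot + 1 ≡ n
  ∑nonRoot = begin
    sum nonRoot + 1                         ≡⟨ cong (sum nonRoot +_) count-r ⟨
    sum nonRoot + count (_≟ᶠ r)             ≡⟨ ∑-distrib-+ nonRoot (λ v → 𝟙 (v ≟ᶠ r)) ⟨
    sum (λ v → nonRoot v + 𝟙 (v ≟ᶠ r))      ≡⟨ sum-cong-≗ (λ v → 𝟙-¬ (v ≟ᶠ r)) ⟩
    sum {n} (λ _ → 1)                       ≡⟨ sum-ones n ⟩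
    n                                       ∎
    where
    open ≡-Reasoning
    count-r : count (_≟ᶠ r) ≡ 1
    count-r = ≤-antisym (count-≤1 (_≟ᶠ r) (λ v≡r w≡r → trans v≡r (sym w≡r))) (count-pos (_≟ᶠ r) refl)

  ∑indegree : sum indegree + 1 ≡ n
  ∑indegree = begin
    sum indegree + 1        ≡⟨ cong (_+ 1) (∑-comm (λ u v → 𝟙 (D u v ≟ᴮ true))) ⟨
    sum (outdegree D) + 1   ≡⟨ cong (_+ 1) (arcCount≡∑outdegree D) ⟨
    arcCount D + 1          ≡⟨ proj₁ (proj₂ out) ⟩
    n                       ∎
    where open ≡-Reasoning

  pathsFromRoot : ∀ v → Star (flip (Arc D)) v r
  pathsFromRoot v = reverse id (proj₂ (proj₂ out) v)

  nonRoot≤indegree : ∀ v → nonRoot v ≤ indegree v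
  nonRoot≤indegree v with v ≟ᶠ r | pathsFromRoot v
  ... | yes _   | _          = z≤n
  ... | no v≢r  | ε          = ⊥-elim (v≢r refl)
  ... | no _    | (u→v ◅ _)  = count-pos (λ u → D u v ≟ᴮ true) u→v

  indegree≡nonRoot : ∀ v → indegree v ≡ nonRoot v
  indegree≡nonRoot v with indegree v ≤? nonRoot v
  ... | yes ≤nonRoot = ≤-antisym ≤nonRoot (nonRoot≤indegree v)
  ... | no  ≰nonRoot = ⊥-elim (<-irrefl (+-cancelʳ-≡ 1 _ _ (trans ∑nonRoot (sym ∑indegree)))
                                        (sum-mono-< nonRoot≤indegree v (≰⇒> ≰nonRoot)))

  parent : Fin n → Fin n
  parent v with any? (λ u → D u v ≟ᴮ true)
  ... | yes (u , _) = u
  ... | no _        = r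

  arc⇒parent : ∀ {u v} → Arc D u v → v ≢ r × parent v ≡ u
  arc⇒parent {u} {v} u→v = v≢r , parent-v≡u
    where
    v≢r : v ≢ r
    v≢r refl = <-irrefl refl (≤-trans (count-pos (λ u → D u r ≟ᴮ true) u→v) (≤-reflexive (trans (indegree≡nonRoot r) (𝟙-no (¬? (r ≟ᶠ r)) (λ r≢r → r≢r refl)))))
    parent-v≡u : parent v ≡ u
    parent-v≡u with any? (λ u → D u v ≟ᴮ true)
    ... | no none = ⊥-elim (none (u , u→v))
    ... | yes (u′ , u′→v) with u′ ≟ᶠ u
    ...   | yes u′≡u = u′≡u
    ...   | no  u′≢u = ⊥-elim (<-irrefl refl (≤-trans (count-≥2 (λ u → D u v ≟ᴮ true) u′≢u u′→v u→v)
                                             (≤-trans (≤-reflexive (indegree≡nonRoot v)) (𝟙≤1 _))))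

  reachesRoot : ReachesRoot r parent
  reachesRoot v = climb (pathsFromRoot v)
    where
    climb : ∀ {v} → Star (flip (Arc D)) v r → ∃ λ t → ancestor r parent t v ≡ r
    climb ε = 0 , refl
    climb (u→v ◅ path) with climb path
    ... | t , e = suc t , subst (λ z → ancestor r parent t z ≡ r) (sym (proj₂ (arc⇒parent u→v))) e

  childless⇒leaf : ∀ {w} → Childless r parent w → degree D w ≤ 1
  childless⇒leaf {w} childless = subst (_≤ 1) (sym (degree≡count D w))
    (count-≤1 (λ v → adjacent D w v ≟ᴮ true) (λ adj adj′ → trans (toParent adj) (sym (toParent adj′))))
    where
    toParent : ∀ {v} → adjacent D w v ≡ true → v ≡ parent w
    toParent {v} adj with D w v in w→v | D v w in v→w
    ... | true  | _     = ⊥-elim (childless v (arc⇒parent w→v))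
    ... | false | true  = sym (proj₂ (arc⇒parent v→w))
    toParent () | false | false

  childlessCount≤leafCount : childlessCount r parent ≤ leafCount D
  childlessCount≤leafCount = subst (childlessCount r parent ≤_) (sym (leafCount≡count D))
    (count-mono (childless? r parent) (λ u → degree D u ≤? 1) childless⇒leaf)


outArborescence-unavoidable : {D : Digraph n} {r : Fin n} → IsOutArborescence D r →
                              Unavoidable (n + leafCount D ∸ 1) D
outArborescence-unavoidable {n} {D} {r} out T = f , f-injective , arcs
  where
  open OutArborescence out
  bound : n + RootedTree.childlessCount r parent ≤ suc (n + leafCount D ∸ 1)
  bound = ≤-trans (+-monoʳ-≤ n childlessCount≤leafCount) (m≤n+m∸n (n + leafCount D) 1)
  embedding = TournamentEmbedding.treeEmbedding T r parent reachesRoot bound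
  f : Fin n → Fin (n + leafCount D ∸ 1)
  f = proj₁ embedding
  f-injective : Injective _≡_ _≡_ f
  f-injective = proj₁ (proj₂ embedding)
  arcs : ∀ u v → Arc D u v → Arc (Tournament.arc T) (f u) (f v)
  arcs u v u→v = subst (λ z → Arc (Tournament.arc T) (f z) (f v)) (proj₂ (arc⇒parent u→v)) (proj₂ (proj₂ embedding) (proj₁ (arc⇒parent u→v)))
converse : ∀ {m} → Tournament m → Tournament m
converse T = record
  { arc         = flip arc
  ; irreflexive = irreflexive
  ; exactlyOne  = λ u v u≢v → exactlyOne v u (u≢v ∘ sym)
  }
  where open Tournament T

unavoidable-flip : ∀ {m} {D : Digraph n} → Unavoidable m (flip D) → Unavoidable m D
unavoidable-flip unavoidable T with unavoidable (converse T)
... | f , f-injective , f-arcs = f , f-injective , λ u v u→v → f-arcs v u u→v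

inArborescence⇒flip-out : {D : Digraph n} {r : Fin n} → IsInArborescence D r → IsOutArborescence (flip D) r
inArborescence⇒flip-out {D = D} ((irreflexive , asymmetric) , arcCount+1≡n , paths) =
  (irreflexive , λ u v → asymmetric v u) , trans (cong (_+ 1) (arcCount-flip D)) arcCount+1≡n ,
  λ v → reverse id (paths v)

mainTheorem1 : (n k : ℕ) (D : Digraph n) → IsArborescence D → leafCount D ≡ k →
    Unavoidable (n + k ∸ 1) D
mainTheorem1 n k D (r , inj₁ out) refl = outArborescence-unavoidable out
mainTheorem1 n k D (r , inj₂ inArb) refl =
  unavoidable-flip (subst (λ l → Unavoidable (n + l ∸ 1) (flip D)) (leafCount-flip D)
                          (outArborescence-unavoidable (inArborescence⇒flip-out inArb)))
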